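{- Let $n>2k$ and let $\mathcal{F}\subset\binom{[n]}{k}$ be an intersecting family with $\tau(\mathcal{F})\geq 3$ such that $|F\cap[5]|\geq 2$ for all $F\in\mathcal{F}$. Then for all $P,P'\in\binom{[5]}{2}$ with $P\cap P'=\emptyset$, \[ f_P+f_{P'}+f_{[5]\setminus P}+f_{[5]\setminus P'}\leq\binom{n-5}{k-2}+\binom{n-5}{k-3}. \]
   Context: A family is intersecting if any two members intersect; $\tau(\mathcal{F})$ is the minimum size of a set meeting every member of $\mathcal{F}$. With $U=[5]$, for $S\subset U$ let $\mathcal{F}(S,U)=\{F\setminus U: F\in\mathcal{F},\ F\cap U=S\}$ and $f_S=|\mathcal{F}(S,U)|$. -}

module Defs where

open import Data.Nat using (ℕ; _<ᵇ_)
open import Data.Bool using (if_then_else_)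
open import Data.Fin using (Fin; toℕ)
open import Data.Fin.Subset using (Subset; inside; outside; _∩_; Nonempty; ∣_∣)
open import Data.Bool.Properties using () renaming (_≟_ to _≟ᵇ_)
open import Data.Vec.Properties using (≡-dec)
open import Data.Vec using (tabulate)
open import Data.List using (List; filter; length)
open import Data.List.Membership.Propositional using () renaming (_∈_ to _∈ₗ_)

U5 : ∀ {n} → Subset n
U5 = tabulate (λ i → if toℕ i <ᵇ 5 then inside else outside)

-- A family of subsets of [n], given as a list (assumed duplicate-free separately).
Family : ℕ → Set
Family n = List (Subset n)

Uniform : ∀ {n} → ℕ → Family n → Set
Uniform k ℱ = ∀ {F} → F ∈ₗ ℱ → ∣ F ∣ ≡ k
  where open import Relation.Binary.PropositionalEquality using (_≡_)

Intersecting : ∀ {n} → Family n → Set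
Intersecting ℱ = ∀ {F G} → F ∈ₗ ℱ → G ∈ₗ ℱ → Nonempty (F ∩ G)

IsTransversal : ∀ {n} → Family n → Subset n → Set
IsTransversal ℱ T = ∀ {F} → F ∈ₗ ℱ → Nonempty (T ∩ F)

τ≥ : ∀ {n} → Family n → ℕ → Set
τ≥ ℱ m = ∀ T → IsTransversal ℱ T → m ≤ ∣ T ∣
  where open import Data.Nat using (_≤_)

-- f_S = |ℱ(S,U)| with U = [5]: the number of F ∈ ℱ with F ∩ [5] = S.
-- (F ↦ F ∖ U is injective on {F : F ∩ U = S}, so this equals |ℱ(S,U)|.)
f : ∀ {n} → Family n → Subset n → ℕ
f ℱ S = length (filter (λ F → ≡-dec _≟ᵇ_ (F ∩ U5) S) ℱ)

-- Put X = P ∪ P′ and W = [n] ∖ X. A member of ℱ whose trace on [5] is P or [5] ∖ P′ contains P and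
-- avoids P′, so its trace on X is P and it is determined by its trace on W, a (k−2)-subset of W; the
-- same holds with P and P′ exchanged. Since P ∩ P′ = ∅, a member of the first class and one of the
-- second meet inside W, so the two families of traces are cross-intersecting (k−2)-uniform families on
-- the n − 4 points of W, and |𝒢| + |ℋ| ≤ C(n−4, k−2) = C(n−5, k−2) + C(n−5, k−3).
-- The cross-intersecting bound is proved in the weighted form |𝒢|/C(m,a) + |ℋ|/C(m,b) ≤ 1 (a + b ≤ m),
-- by induction on the ground set, splitting both families into the deletion and the link of a point.
module Submission where

open import Defs
open import Data.Nat using (ℕ; _+_; _∸_; _≤_; _<_; _*_)
open import Data.Nat.Combinatorics using (_C_)
open import Data.Fin.Subset using (Subset; _∩_; _─_; _⊆_; ∣_∣; ⊥)
open import Data.List.Relation.Unary.Unique.Propositional using (Unique)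
open import Data.List.Membership.Propositional using () renaming (_∈_ to _∈ₗ_)
open import Relation.Binary.PropositionalEquality using (_≡_)

open import Data.Bool using (Bool; _∧_)
open import Data.Bool.Properties using (∧-zeroʳ; ∧-identityʳ) renaming (_≟_ to _≟ᵇ_)
open import Data.Empty using (⊥-elim)
open import Data.Fin using (Fin; zero; suc)
open import Data.Fin.Subset using (Nonempty; _∪_; ∁; _∈_; _∉_; inside; outside; ⊤)
open import Data.Fin.Subset.Properties
  using ( _∈?_; ∣p∣≤∣x∷p∣; ∣p∩q∣≤∣p∣; ∣⊥∣≡0; ∣∁p∣≡n∸∣p∣; ∉⊥; x∉p⇒x∈∁p; x∈p∩q⁺; x∈p∩q⁻
        ; x∈p∧x∉q⇒x∈p─q; ⊆-antisym; drop-∷-⊆; p∩q⊆p; p∩q⊆q; p∪∁p≡⊤; ∩-assoc; ∩-comm; ∩-identityʳ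
        ; ∩-inverseˡ; ∩-zeroʳ; ∩-distribˡ-∪; ∪-comm; ∪-identityʳ)
open import Data.List using (List; []; _∷_; length; map; filter)
open import Data.List.Properties using (length-map; map-∘; map-id-local)
open import Data.List.Membership.Propositional.Properties using (∈-map⁻; ∈-filter⁻)
import Data.List.Relation.Unary.All as All
open import Data.List.Relation.Unary.AllPairs using ([]; _∷_)
open import Data.List.Relation.Unary.Any using (here; there)
open import Data.List.Relation.Unary.Unique.Propositional.Properties using (filter⁺; map⁻)
open import Data.Nat using (suc; zero; s≤s; z≤n; NonZero; >-nonZero)
open import Data.Nat.Combinatorics using (nCk+nC[k+1]≡[n+1]C[k+1]; nC1≡n)
open import Data.Nat.Properties
open import Data.Nat.Tactic.RingSolver using (solve-∀)
open import Data.Product using (_,_; proj₁; proj₂)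
open import Data.Sum using (_⊎_; inj₁; inj₂)
open import Data.Vec using ([]; _∷_; tabulate)
import Data.Vec.Base as Vec
open import Data.Vec.Properties using (∷-injectiveʳ; ≡-dec; tabulate-cong; tabulate∘lookup; lookup-replicate)
open import Function using (_∘_)
open import Relation.Binary.PropositionalEquality
  using (_≢_; refl; sym; trans; cong; cong₂; subst; subst₂; module ≡-Reasoning)
open import Relation.Nullary using (yes; no; ¬_)
open import Relation.Nullary.Decidable using (_⊎-dec_)
open import Relation.Unary using (Decidable)

private
  variable
    n : ℕ

[1+k]*[1+n]C[1+k]≡[1+n]*nCk : ∀ n k → suc k * (suc n C suc k) ≡ suc n * (n C k)
[1+k]*[1+n]C[1+k]≡[1+n]*nCk n zero =
  trans (*-identityˡ (suc n C 1)) (trans (nC1≡n (suc n)) (sym (*-identityʳ (suc n))))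
[1+k]*[1+n]C[1+k]≡[1+n]*nCk zero (suc k) = *-zeroʳ (2 + k)
[1+k]*[1+n]C[1+k]≡[1+n]*nCk (suc n) (suc k) = begin
  (2 + k) * ((2 + n) C (2 + k))                   ≡⟨ cong ((2 + k) *_) (sym (nCk+nC[k+1]≡[n+1]C[k+1] (suc n) (suc k))) ⟩
  (2 + k) * (x + y)                               ≡⟨ regroup k x y ⟩
  x + ((1 + k) * x + (2 + k) * y)                 ≡⟨ cong (x +_) (cong₂ _+_ ([1+k]*[1+n]C[1+k]≡[1+n]*nCk n k)
                                                                         ([1+k]*[1+n]C[1+k]≡[1+n]*nCk n (suc k))) ⟩
  x + ((1 + n) * (n C k) + (1 + n) * (n C suc k)) ≡⟨ cong (x +_) (sym (*-distribˡ-+ (1 + n) (n C k) (n C suc k))) ⟩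
  x + (1 + n) * (n C k + n C suc k)               ≡⟨ cong (λ z → x + (1 + n) * z) (nCk+nC[k+1]≡[n+1]C[k+1] n k) ⟩
  (2 + n) * x                                     ∎
  where
  open ≡-Reasoning
  x y : ℕ
  x = suc n C suc k
  y = suc n C (2 + k)
  regroup : ∀ k x y → (2 + k) * (x + y) ≡ x + ((1 + k) * x + (2 + k) * y)
  regroup = solve-∀

k≤n⇒nCk>0 : ∀ {n k} → k ≤ n → 0 < n C k
k≤n⇒nCk>0 {n} {zero} _ = s≤s z≤n
k≤n⇒nCk>0 {suc n} {suc k} (s≤s k≤n) =
  subst (0 <_) (nCk+nC[k+1]≡[n+1]C[k+1] n k) (<-≤-trans (k≤n⇒nCk>0 k≤n) (m≤m+n (n C k) (n C suc k)))

k≤n⇒nCk≢0 : ∀ {n k} → k ≤ n → NonZero (n C k)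
k≤n⇒nCk≢0 k≤n = >-nonZero (k≤n⇒nCk>0 k≤n)

[1+n]Ck≤nCk+nC[k∸1] : ∀ n k → suc n C k ≤ n C k + n C (k ∸ 1)
[1+n]Ck≤nCk+nC[k∸1] n zero    = s≤s z≤n
[1+n]Ck≤nCk+nC[k∸1] n (suc k) =
  ≤-reflexive (trans (sym (nCk+nC[k+1]≡[n+1]C[k+1] n k)) (+-comm (n C k) (n C suc k)))

-- The inductive step of the weighted bound

absorption-complement : ∀ α γ N q p → α + γ ≡ N → α * (q + p) ≡ N * q → γ * (q + p) ≡ N * p
absorption-complement α γ N q p α+γ≡N αA≡Nq = +-cancelʳ-≡ (α * (q + p)) (γ * (q + p)) (N * p) (begin
  γ * (q + p) + α * (q + p) ≡⟨ sym (*-distribʳ-+ (q + p) γ α) ⟩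
  (γ + α) * (q + p)         ≡⟨ cong (_* (q + p)) (trans (+-comm γ α) α+γ≡N) ⟩
  N * (q + p)               ≡⟨ *-distribˡ-+ N q p ⟩
  N * q + N * p             ≡⟨ +-comm (N * q) (N * p) ⟩
  N * p + N * q             ≡⟨ cong (N * p +_) (sym αA≡Nq) ⟩
  N * p + α * (q + p)       ∎)
  where open ≡-Reasoning

-- With densities x₀ = g₀/p, x₁ = g₁/q, y₀ = h₀/r, y₁ = h₁/s and N = α + β + ε, the two identities say
-- q/(q+p) = α/N and s/(s+r) = β/N, so (g₀+g₁)/(q+p) + (h₀+h₁)/(s+r) is the convex combination
-- (β(x₀+y₁) + α(x₁+y₀) + ε(x₀+y₀))/N of three quantities that are at most 1.
convex-combination-bound : ∀ α β ε p q r s g₀ g₁ h₀ h₁ →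
  .{{NonZero (α + β + ε)}} → .{{NonZero p}} → .{{NonZero q}} → .{{NonZero r}} → .{{NonZero s}} →
  α * (q + p) ≡ (α + β + ε) * q → β * (s + r) ≡ (α + β + ε) * s →
  g₀ * s + h₁ * p ≤ p * s → g₁ * r + h₀ * q ≤ q * r → ε * (g₀ * r + h₀ * p) ≤ ε * (p * r) →
  (g₀ + g₁) * (s + r) + (h₀ + h₁) * (q + p) ≤ (q + p) * (s + r)
convex-combination-bound α β ε p q r s g₀ g₁ h₀ h₁ αA≡Nq βB≡Ns g₀h₁ g₁h₀ g₀h₀ =
  *-cancelˡ-≤ K {{K≢0}} (begin
    K * (g * B + h * A) ≡⟨ sym X*AB≡K*[gB+hA] ⟩
    X * (A * B)         ≤⟨ *-monoˡ-≤ (A * B) X≤Y ⟩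
    Y * (A * B)         ≡⟨ cong (_* (A * B)) (Y≡K α β ε p q r s) ⟩
    K * (A * B)         ∎)
  where
  open ≤-Reasoning
  N A B g h K X Y : ℕ
  N = α + β + ε
  A = q + p
  B = s + r
  g = g₀ + g₁
  h = h₀ + h₁
  K = N * (p * q * r * s)
  K≢0 : NonZero K
  K≢0 = m*n≢0 N (p * q * r * s)
    where
    instance
      pq≢0 : NonZero (p * q)
      pq≢0 = m*n≢0 p q
      pqr≢0 : NonZero (p * q * r)
      pqr≢0 = m*n≢0 (p * q) r
      pqrs≢0 : NonZero (p * q * r * s)
      pqrs≢0 = m*n≢0 (p * q * r) s
  X = β * (q * r) * (g₀ * s + h₁ * p) + α * (p * s) * (g₁ * r + h₀ * q) + (q * s) * (ε * (g₀ * r + h₀ * p))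
  Y = β * (q * r) * (p * s) + α * (p * s) * (q * r) + (q * s) * (ε * (p * r))
  X≤Y : X ≤ Y
  X≤Y = +-mono-≤ (+-mono-≤ (*-monoʳ-≤ (β * (q * r)) g₀h₁) (*-monoʳ-≤ (α * (p * s)) g₁h₀))
                 (*-monoʳ-≤ (q * s) g₀h₀)
  Y≡K : ∀ α β ε p q r s → β * (q * r) * (p * s) + α * (p * s) * (q * r) + (q * s) * (ε * (p * r))
                          ≡ (α + β + ε) * (p * q * r * s)
  Y≡K = solve-∀
  γA≡Np : (β + ε) * A ≡ N * p
  γA≡Np = absorption-complement α (β + ε) N q p (sym (+-assoc α β ε)) αA≡Nq
  δB≡Nr : (α + ε) * B ≡ N * r
  δB≡Nr = absorption-complement β (α + ε) N s r (trans (sym (+-assoc β α ε)) (cong (_+ ε) (+-comm β α))) βB≡Ns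
  expand : ∀ α β ε p q r s g₀ g₁ h₀ h₁ →
    (β * (q * r) * (g₀ * s + h₁ * p) + α * (p * s) * (g₁ * r + h₀ * q) + (q * s) * (ε * (g₀ * r + h₀ * p)))
      * ((q + p) * (s + r))
    ≡ g₀ * (q * r * s) * (s + r) * ((β + ε) * (q + p)) + g₁ * (p * r * s) * (s + r) * (α * (q + p))
      + h₀ * (p * q * s) * (q + p) * ((α + ε) * (s + r)) + h₁ * (p * q * r) * (q + p) * (β * (s + r))
  expand = solve-∀
  collect : ∀ N p q r s g₀ g₁ h₀ h₁ A B →
    g₀ * (q * r * s) * B * (N * p) + g₁ * (p * r * s) * B * (N * q)
      + h₀ * (p * q * s) * A * (N * r) + h₁ * (p * q * r) * A * (N * s)
    ≡ N * (p * q * r * s) * ((g₀ + g₁) * B + (h₀ + h₁) * A)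
  collect = solve-∀
  X*AB≡K*[gB+hA] : X * (A * B) ≡ K * (g * B + h * A)
  X*AB≡K*[gB+hA] = begin-equality
    X * (A * B)
      ≡⟨ expand α β ε p q r s g₀ g₁ h₀ h₁ ⟩
    g₀ * (q * r * s) * B * ((β + ε) * A) + g₁ * (p * r * s) * B * (α * A)
      + h₀ * (p * q * s) * A * ((α + ε) * B) + h₁ * (p * q * r) * A * (β * B)
      ≡⟨ cong₂ _+_ (cong₂ _+_ (cong₂ _+_ (cong (g₀ * (q * r * s) * B *_) γA≡Np)
                                         (cong (g₁ * (p * r * s) * B *_) αA≡Nq))
                              (cong (h₀ * (p * q * s) * A *_) δB≡Nr))
                   (cong (h₁ * (p * q * r) * A *_) βB≡Ns) ⟩
    g₀ * (q * r * s) * B * (N * p) + g₁ * (p * r * s) * B * (N * q)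
      + h₀ * (p * q * s) * A * (N * r) + h₁ * (p * q * r) * A * (N * s)
      ≡⟨ collect N p q r s g₀ g₁ h₀ h₁ A B ⟩
    K * (g * B + h * A)
      ∎

m+[1+o]≡1+n⇒m≤n : ∀ {m n} o → m + suc o ≡ suc n → m ≤ n
m+[1+o]≡1+n⇒m≤n {m} o eq = subst (m ≤_) (suc-injective (trans (sym (+-suc m o)) eq)) (m≤m+n m o)

weighted-bound-suc : ∀ m a b g₀ g₁ h₀ h₁ → suc a + suc b ≤ suc m →
  g₀ * (m C b) + h₁ * (m C suc a) ≤ (m C suc a) * (m C b) →
  g₁ * (m C suc b) + h₀ * (m C a) ≤ (m C a) * (m C suc b) →
  (suc a + suc b ≤ m → g₀ * (m C suc b) + h₀ * (m C suc a) ≤ (m C suc a) * (m C suc b)) →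
  (g₀ + g₁) * (suc m C suc b) + (h₀ + h₁) * (suc m C suc a) ≤ (suc m C suc a) * (suc m C suc b)
weighted-bound-suc m a b g₀ g₁ h₀ h₁ a+b≤1+m g₀h₁ g₁h₀ g₀h₀ =
  subst₂ (λ A B → (g₀ + g₁) * B + (h₀ + h₁) * A ≤ A * B)
    (nCk+nC[k+1]≡[n+1]C[k+1] m a) (nCk+nC[k+1]≡[n+1]C[k+1] m b)
    (convex-combination-bound (suc a) (suc b) ε (m C suc a) (m C a) (m C suc b) (m C b) g₀ g₁ h₀ h₁
      (trans (absorption a) (cong (_* (m C a)) (sym a+b+ε≡1+m)))
      (trans (absorption b) (cong (_* (m C b)) (sym a+b+ε≡1+m)))
      g₀h₁ g₁h₀ (weighted-g₀h₀ ε a+b+ε≡1+m))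
  where
  ε : ℕ
  ε = proj₁ (m≤n⇒∃[o]m+o≡n a+b≤1+m)
  a+b+ε≡1+m : suc a + suc b + ε ≡ suc m
  a+b+ε≡1+m = proj₂ (m≤n⇒∃[o]m+o≡n a+b≤1+m)
  1+a+b≤m : suc a + b ≤ m
  1+a+b≤m = ≤-pred (subst (_≤ suc m) (+-suc (suc a) b) a+b≤1+m)
  a+1+b≤m : a + suc b ≤ m
  a+1+b≤m = ≤-pred a+b≤1+m
  instance
    p≢0 : NonZero (m C suc a)
    p≢0 = k≤n⇒nCk≢0 (≤-trans (m≤m+n (suc a) b) 1+a+b≤m)
    q≢0 : NonZero (m C a)
    q≢0 = k≤n⇒nCk≢0 (≤-trans (m≤m+n a (suc b)) a+1+b≤m)
    r≢0 : NonZero (m C suc b)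
    r≢0 = k≤n⇒nCk≢0 (≤-trans (m≤n+m (suc b) a) a+1+b≤m)
    s≢0 : NonZero (m C b)
    s≢0 = k≤n⇒nCk≢0 (≤-trans (m≤n+m b (suc a)) 1+a+b≤m)
  absorption : ∀ c → suc c * (m C c + m C suc c) ≡ suc m * (m C c)
  absorption c = trans (cong (suc c *_) (nCk+nC[k+1]≡[n+1]C[k+1] m c)) ([1+k]*[1+n]C[1+k]≡[1+n]*nCk m c)
  -- When suc a + suc b = suc m the two deletions need not satisfy the hypothesis of the bound, but then ε = 0.
  weighted-g₀h₀ : ∀ ε → suc a + suc b + ε ≡ suc m →
    ε * (g₀ * (m C suc b) + h₀ * (m C suc a)) ≤ ε * ((m C suc a) * (m C suc b))
  weighted-g₀h₀ zero    _  = z≤n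
  weighted-g₀h₀ (suc ε) eq = *-monoʳ-≤ (suc ε) (g₀h₀ (m+[1+o]≡1+n⇒m≤n ε eq))

Nonempty⇒∣p∣>0 : {p : Subset n} → Nonempty p → 0 < ∣ p ∣
Nonempty⇒∣p∣>0 {p = inside ∷ p} (zero , Vec.here)       = s≤s z≤n
Nonempty⇒∣p∣>0 {p = x ∷ p}      (suc i , Vec.there i∈p) =
  <-≤-trans (Nonempty⇒∣p∣>0 (i , i∈p)) (∣p∣≤∣x∷p∣ x p)

drop-∷-Nonempty : {p : Subset n} → Nonempty (outside ∷ p) → Nonempty p
drop-∷-Nonempty (suc i , Vec.there i∈p) = i , i∈p

inside∷⊈outside∷ : {p q : Subset n} → ¬ (inside ∷ p ⊆ outside ∷ q)
inside∷⊈outside∷ p⊆q with p⊆q Vec.here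
... | ()

disjoint⇒∉ : {p q : Subset n} {x : Fin n} → p ∩ q ≡ ⊥ → x ∈ p → x ∉ q
disjoint⇒∉ p∩q≡⊥ x∈p x∈q = ∉⊥ (subst (_ ∈_) p∩q≡⊥ (x∈p∩q⁺ (x∈p , x∈q)))

p∩q≡r⇒r⊆p : {p q r : Subset n} → p ∩ q ≡ r → r ⊆ p
p∩q≡r⇒r⊆p {p = p} {q} p∩q≡r x∈r = p∩q⊆p p q (subst (_ ∈_) (sym p∩q≡r) x∈r)

p⊆q⇒q∩p≡p : {p q : Subset n} → p ⊆ q → q ∩ p ≡ p
p⊆q⇒q∩p≡p {p = p} {q} p⊆q = ⊆-antisym (p∩q⊆q q p) (λ x∈p → x∈p∩q⁺ (p⊆q x∈p , x∈p))

p─q≡p∩∁q : (p q : Subset n) → p ─ q ≡ p ∩ ∁ q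
p─q≡p∩∁q []      []            = refl
p─q≡p∩∁q (x ∷ p) (inside  ∷ q) = cong₂ _∷_ (sym (∧-zeroʳ x)) (p─q≡p∩∁q p q)
p─q≡p∩∁q (x ∷ p) (outside ∷ q) = cong₂ _∷_ (sym (∧-identityʳ x)) (p─q≡p∩∁q p q)

[p─q]∩q≡⊥ : (p q : Subset n) → (p ─ q) ∩ q ≡ ⊥
[p─q]∩q≡⊥ p q = begin
  (p ─ q) ∩ q   ≡⟨ cong (_∩ q) (p─q≡p∩∁q p q) ⟩
  (p ∩ ∁ q) ∩ q ≡⟨ ∩-assoc p (∁ q) q ⟩
  p ∩ (∁ q ∩ q) ≡⟨ cong (p ∩_) (∩-inverseˡ q) ⟩
  p ∩ ⊥         ≡⟨ ∩-zeroʳ p ⟩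
  ⊥             ∎
  where open ≡-Reasoning

p≡[p∩q]∪[p∩∁q] : (p q : Subset n) → p ≡ (p ∩ q) ∪ (p ∩ ∁ q)
p≡[p∩q]∪[p∩∁q] p q = begin
  p                   ≡⟨ sym (∩-identityʳ p) ⟩
  p ∩ ⊤               ≡⟨ cong (p ∩_) (sym (p∪∁p≡⊤ q)) ⟩
  p ∩ (q ∪ ∁ q)       ≡⟨ ∩-distribˡ-∪ p q (∁ q) ⟩
  (p ∩ q) ∪ (p ∩ ∁ q) ∎
  where open ≡-Reasoning

trace-restrict : {F U S Q : Subset n} → F ∩ U ≡ S → Q ⊆ U → F ∩ Q ≡ S ∩ Q
trace-restrict {F = F} {U} {S} {Q} F∩U≡S Q⊆U = begin
  F ∩ Q       ≡⟨ cong (F ∩_) (sym (p⊆q⇒q∩p≡p Q⊆U)) ⟩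
  F ∩ (U ∩ Q) ≡⟨ sym (∩-assoc F U Q) ⟩
  (F ∩ U) ∩ Q ≡⟨ cong (_∩ Q) F∩U≡S ⟩
  S ∩ Q       ∎
  where open ≡-Reasoning

∣p∣≡∣p∩q∣+∣p∩∁q∣ : (p q : Subset n) → ∣ p ∣ ≡ ∣ p ∩ q ∣ + ∣ p ∩ ∁ q ∣
∣p∣≡∣p∩q∣+∣p∩∁q∣ []            []            = refl
∣p∣≡∣p∩q∣+∣p∩∁q∣ (inside  ∷ p) (inside  ∷ q) = cong suc (∣p∣≡∣p∩q∣+∣p∩∁q∣ p q)
∣p∣≡∣p∩q∣+∣p∩∁q∣ (inside  ∷ p) (outside ∷ q) =
  trans (cong suc (∣p∣≡∣p∩q∣+∣p∩∁q∣ p q)) (sym (+-suc _ _))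
∣p∣≡∣p∩q∣+∣p∩∁q∣ (outside ∷ p) (_       ∷ q) = ∣p∣≡∣p∩q∣+∣p∩∁q∣ p q

∣p∣≡∣q∣+∣p─q∣ : {p q : Subset n} → q ⊆ p → ∣ p ∣ ≡ ∣ q ∣ + ∣ p ─ q ∣
∣p∣≡∣q∣+∣p─q∣ {p = p} {q} q⊆p = trans (∣p∣≡∣p∩q∣+∣p∩∁q∣ p q)
  (cong₂ _+_ (cong ∣_∣ (p⊆q⇒q∩p≡p q⊆p)) (cong ∣_∣ (sym (p─q≡p∩∁q p q))))

∣p∪q∣≡∣p∣+∣q∣ : (p q : Subset n) → p ∩ q ≡ ⊥ → ∣ p ∪ q ∣ ≡ ∣ p ∣ + ∣ q ∣
∣p∪q∣≡∣p∣+∣q∣ []            []            _  = refl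
∣p∪q∣≡∣p∣+∣q∣ (inside  ∷ p) (inside  ∷ q) ()
∣p∪q∣≡∣p∣+∣q∣ (inside  ∷ p) (outside ∷ q) eq = cong suc (∣p∪q∣≡∣p∣+∣q∣ p q (∷-injectiveʳ eq))
∣p∪q∣≡∣p∣+∣q∣ (outside ∷ p) (inside  ∷ q) eq =
  trans (cong suc (∣p∪q∣≡∣p∣+∣q∣ p q (∷-injectiveʳ eq))) (sym (+-suc _ _))
∣p∪q∣≡∣p∣+∣q∣ (outside ∷ p) (outside ∷ q) eq = ∣p∪q∣≡∣p∣+∣q∣ p q (∷-injectiveʳ eq)

∣tabulate∣≡0 : (g : Fin n → Bool) → (∀ i → g i ≡ outside) → ∣ tabulate g ∣ ≡ 0
∣tabulate∣≡0 {n} g g≡outside = trans (cong ∣_∣ tabulate≡⊥) (∣⊥∣≡0 n)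
  where
  tabulate≡⊥ : tabulate g ≡ ⊥
  tabulate≡⊥ = trans (tabulate-cong (λ i → trans (g≡outside i) (sym (lookup-replicate i outside))))
                     (tabulate∘lookup ⊥)

∣U5∣≡5 : 5 ≤ n → ∣ U5 {n} ∣ ≡ 5
∣U5∣≡5 {n = suc (suc (suc (suc (suc m))))} (s≤s (s≤s (s≤s (s≤s (s≤s _))))) =
  cong (5 +_) (∣tabulate∣≡0 {m} _ (λ _ → refl))

-- Cross-intersecting uniform families

record UniformOn (W : Subset n) (k : ℕ) (𝒢 : Family n) : Set where
  field
    unique  : Unique 𝒢
    uniform : Uniform k 𝒢
    within  : ∀ {G} → G ∈ₗ 𝒢 → G ⊆ W

open UniformOn

CrossIntersecting : Family n → Family n → Set
CrossIntersecting 𝒢 ℋ = ∀ {G H} → G ∈ₗ 𝒢 → H ∈ₗ ℋ → Nonempty (G ∩ H)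

CrossIntersecting-sym : {𝒢 ℋ : Family n} → CrossIntersecting 𝒢 ℋ → CrossIntersecting ℋ 𝒢
CrossIntersecting-sym cross H∈ℋ G∈𝒢 = subst Nonempty (∩-comm _ _) (cross G∈𝒢 H∈ℋ)

deletion link : Family (suc n) → Family n
deletion []                   = []
deletion ((outside ∷ G) ∷ 𝒢) = G ∷ deletion 𝒢
deletion ((inside  ∷ G) ∷ 𝒢) = deletion 𝒢
link []                   = []
link ((outside ∷ G) ∷ 𝒢) = link 𝒢
link ((inside  ∷ G) ∷ 𝒢) = G ∷ link 𝒢

length≡deletion+link : (𝒢 : Family (suc n)) → length 𝒢 ≡ length (deletion 𝒢) + length (link 𝒢)
length≡deletion+link []                   = refl
length≡deletion+link ((outside ∷ G) ∷ 𝒢) = cong suc (length≡deletion+link 𝒢)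
length≡deletion+link ((inside  ∷ G) ∷ 𝒢) = trans (cong suc (length≡deletion+link 𝒢)) (sym (+-suc _ _))

length-deletion : {𝒢 : Family (suc n)} → (∀ {G} → ¬ (inside ∷ G ∈ₗ 𝒢)) → length (deletion 𝒢) ≡ length 𝒢
length-deletion {𝒢 = []}                  _       = refl
length-deletion {𝒢 = (outside ∷ G) ∷ 𝒢} no-link = cong suc (length-deletion (no-link ∘ there))
length-deletion {𝒢 = (inside  ∷ G) ∷ 𝒢} no-link = ⊥-elim (no-link (here refl))

∈-deletion⁻ : {G : Subset n} (𝒢 : Family (suc n)) → G ∈ₗ deletion 𝒢 → outside ∷ G ∈ₗ 𝒢
∈-deletion⁻ ((outside ∷ _) ∷ _) (here refl) = here refl
∈-deletion⁻ ((outside ∷ _) ∷ 𝒢) (there G∈)  = there (∈-deletion⁻ 𝒢 G∈)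
∈-deletion⁻ ((inside  ∷ _) ∷ 𝒢) G∈          = there (∈-deletion⁻ 𝒢 G∈)

∈-link⁻ : {G : Subset n} (𝒢 : Family (suc n)) → G ∈ₗ link 𝒢 → inside ∷ G ∈ₗ 𝒢
∈-link⁻ ((inside  ∷ _) ∷ _) (here refl) = here refl
∈-link⁻ ((inside  ∷ _) ∷ 𝒢) (there G∈)  = there (∈-link⁻ 𝒢 G∈)
∈-link⁻ ((outside ∷ _) ∷ 𝒢) G∈          = there (∈-link⁻ 𝒢 G∈)

Unique-deletion : (𝒢 : Family (suc n)) → Unique 𝒢 → Unique (deletion 𝒢)
Unique-deletion []                   _             = []
Unique-deletion ((outside ∷ G) ∷ 𝒢) (G∉𝒢 ∷ 𝒢!) =
  All.tabulate (λ G′∈ G≡G′ → All.lookup G∉𝒢 (∈-deletion⁻ 𝒢 G′∈) (cong (outside ∷_) G≡G′))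
  ∷ Unique-deletion 𝒢 𝒢!
Unique-deletion ((inside  ∷ G) ∷ 𝒢) (_ ∷ 𝒢!)   = Unique-deletion 𝒢 𝒢!

Unique-link : (𝒢 : Family (suc n)) → Unique 𝒢 → Unique (link 𝒢)
Unique-link []                   _             = []
Unique-link ((inside  ∷ G) ∷ 𝒢) (G∉𝒢 ∷ 𝒢!) =
  All.tabulate (λ G′∈ G≡G′ → All.lookup G∉𝒢 (∈-link⁻ 𝒢 G′∈) (cong (inside ∷_) G≡G′))
  ∷ Unique-link 𝒢 𝒢!
Unique-link ((outside ∷ G) ∷ 𝒢) (_ ∷ 𝒢!)   = Unique-link 𝒢 𝒢!

deletion-on : ∀ {s} {W : Subset n} {k 𝒢} → UniformOn (s ∷ W) k 𝒢 → UniformOn W k (deletion 𝒢)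
deletion-on {𝒢 = 𝒢} h = record
  { unique  = Unique-deletion 𝒢 (unique h)
  ; uniform = λ G∈ → uniform h (∈-deletion⁻ 𝒢 G∈)
  ; within  = λ G∈ → drop-∷-⊆ (within h (∈-deletion⁻ 𝒢 G∈))
  }

link-on : ∀ {s} {W : Subset n} {k 𝒢} → UniformOn (s ∷ W) (suc k) 𝒢 → UniformOn W k (link 𝒢)
link-on {𝒢 = 𝒢} h = record
  { unique  = Unique-link 𝒢 (unique h)
  ; uniform = λ G∈ → suc-injective (uniform h (∈-link⁻ 𝒢 G∈))
  ; within  = λ G∈ → drop-∷-⊆ (within h (∈-link⁻ 𝒢 G∈))
  }

CrossIntersecting-tails : ∀ {x y} {𝒢 ℋ : Family (suc n)} {𝒢′ ℋ′ : Family n} → x ∧ y ≡ outside →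
  (∀ {G} → G ∈ₗ 𝒢′ → x ∷ G ∈ₗ 𝒢) → (∀ {H} → H ∈ₗ ℋ′ → y ∷ H ∈ₗ ℋ) →
  CrossIntersecting 𝒢 ℋ → CrossIntersecting 𝒢′ ℋ′
CrossIntersecting-tails x∧y≡outside G∈ H∈ cross G∈𝒢′ H∈ℋ′ =
  drop-∷-Nonempty (subst (λ z → Nonempty (z ∷ _)) x∧y≡outside (cross (G∈ G∈𝒢′) (H∈ H∈ℋ′)))

length≤1 : {𝒢 : Family 0} → Unique 𝒢 → length 𝒢 ≤ 1
length≤1 {[]}          _                  = z≤n
length≤1 {[] ∷ []}     _                  = ≤-refl
length≤1 {[] ∷ [] ∷ _} ((≢ All.∷ _) ∷ _) = ⊥-elim (≢ refl)

length≤C : (W : Subset n) {k : ℕ} {𝒢 : Family n} → UniformOn W k 𝒢 → length 𝒢 ≤ ∣ W ∣ C k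
length≤C [] {zero} h = length≤1 (unique h)
length≤C [] {suc k} {[]} h = z≤n
length≤C [] {suc k} {[] ∷ _} h with uniform h (here refl)
... | ()
length≤C (outside ∷ W) {k} h =
  subst (_≤ ∣ W ∣ C k) (length-deletion (inside∷⊈outside∷ ∘ within h)) (length≤C W (deletion-on h))
length≤C (inside ∷ W) {zero} h =
  subst (_≤ 1) (length-deletion (λ G∈ → 1+n≢0 (uniform h G∈))) (length≤C W (deletion-on h))
length≤C (inside ∷ W) {suc k} {𝒢} h = begin
  length 𝒢                               ≡⟨ length≡deletion+link 𝒢 ⟩
  length (deletion 𝒢) + length (link 𝒢) ≤⟨ +-mono-≤ (length≤C W (deletion-on h)) (length≤C W (link-on h)) ⟩
  ∣ W ∣ C suc k + ∣ W ∣ C k              ≡⟨ +-comm (∣ W ∣ C suc k) (∣ W ∣ C k) ⟩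
  ∣ W ∣ C k + ∣ W ∣ C suc k              ≡⟨ nCk+nC[k+1]≡[n+1]C[k+1] ∣ W ∣ k ⟩
  suc ∣ W ∣ C suc k                      ∎
  where open ≤-Reasoning

cross-intersecting-bound₀ : (W : Subset n) (b : ℕ) {𝒢 ℋ : Family n} →
  UniformOn W 0 𝒢 → UniformOn W b ℋ → CrossIntersecting 𝒢 ℋ →
  length 𝒢 * (∣ W ∣ C b) + length ℋ * (∣ W ∣ C 0) ≤ (∣ W ∣ C 0) * (∣ W ∣ C b)
cross-intersecting-bound₀ W b {𝒢} {[]} h𝒢 _ _ =
  subst (_≤ 1 * (∣ W ∣ C b)) (sym (+-identityʳ _)) (*-monoˡ-≤ (∣ W ∣ C b) (length≤C W h𝒢))
cross-intersecting-bound₀ W b {[]} {ℋ} _ hℋ _ =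
  subst₂ _≤_ (sym (*-identityʳ (length ℋ))) (sym (*-identityˡ (∣ W ∣ C b))) (length≤C W hℋ)
cross-intersecting-bound₀ W b {G ∷ _} {H ∷ _} h𝒢 _ cross =
  ⊥-elim (<⇒≱ (Nonempty⇒∣p∣>0 (cross (here refl) (here refl)))
                (≤-trans (∣p∩q∣≤∣p∣ G H) (≤-reflexive (uniform h𝒢 (here refl)))))

cross-intersecting-bound : (W : Subset n) (a b : ℕ) {𝒢 ℋ : Family n} →
  UniformOn W a 𝒢 → UniformOn W b ℋ → CrossIntersecting 𝒢 ℋ → a + b ≤ ∣ W ∣ →
  length 𝒢 * (∣ W ∣ C b) + length ℋ * (∣ W ∣ C a) ≤ (∣ W ∣ C a) * (∣ W ∣ C b)
cross-intersecting-bound W zero b h𝒢 hℋ cross _ = cross-intersecting-bound₀ W b h𝒢 hℋ cross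
cross-intersecting-bound W (suc a) zero {𝒢} {ℋ} h𝒢 hℋ cross _ =
  subst₂ _≤_ (+-comm (length ℋ * (∣ W ∣ C suc a)) (length 𝒢 * 1)) (*-comm 1 (∣ W ∣ C suc a))
    (cross-intersecting-bound₀ W (suc a) hℋ h𝒢 (CrossIntersecting-sym cross))
cross-intersecting-bound [] (suc a) (suc b) _ _ _ ()
cross-intersecting-bound (outside ∷ W) (suc a) (suc b) {𝒢} {ℋ} h𝒢 hℋ cross a+b≤∣W∣ =
  subst₂ (λ g h → g * (∣ W ∣ C suc b) + h * (∣ W ∣ C suc a) ≤ (∣ W ∣ C suc a) * (∣ W ∣ C suc b))
    (length-deletion (inside∷⊈outside∷ ∘ within h𝒢)) (length-deletion (inside∷⊈outside∷ ∘ within hℋ))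
    (cross-intersecting-bound W (suc a) (suc b) (deletion-on h𝒢) (deletion-on hℋ)
      (CrossIntersecting-tails refl (∈-deletion⁻ 𝒢) (∈-deletion⁻ ℋ) cross) a+b≤∣W∣)
cross-intersecting-bound (inside ∷ W) (suc a) (suc b) {𝒢} {ℋ} h𝒢 hℋ cross a+b≤1+m =
  subst₂ (λ g h → g * (suc m C suc b) + h * (suc m C suc a) ≤ (suc m C suc a) * (suc m C suc b))
    (sym (length≡deletion+link 𝒢)) (sym (length≡deletion+link ℋ))
    (weighted-bound-suc m a b g₀ g₁ h₀ h₁ a+b≤1+m
      (cross-intersecting-bound W (suc a) b (deletion-on h𝒢) (link-on hℋ)
        (CrossIntersecting-tails refl (∈-deletion⁻ 𝒢) (∈-link⁻ ℋ) cross) 1+a+b≤m)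
      (cross-intersecting-bound W a (suc b) (link-on h𝒢) (deletion-on hℋ)
        (CrossIntersecting-tails refl (∈-link⁻ 𝒢) (∈-deletion⁻ ℋ) cross) (≤-pred a+b≤1+m))
      (cross-intersecting-bound W (suc a) (suc b) (deletion-on h𝒢) (deletion-on hℋ)
        (CrossIntersecting-tails refl (∈-deletion⁻ 𝒢) (∈-deletion⁻ ℋ) cross)))
  where
  m g₀ g₁ h₀ h₁ : ℕ
  m = ∣ W ∣
  g₀ = length (deletion 𝒢)
  g₁ = length (link 𝒢)
  h₀ = length (deletion ℋ)
  h₁ = length (link ℋ)
  1+a+b≤m : suc a + b ≤ m
  1+a+b≤m = ≤-pred (subst (_≤ suc m) (+-suc (suc a) b) a+b≤1+m)

cross-intersecting-sum≤C : (W : Subset n) (k : ℕ) {𝒢 ℋ : Family n} →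
  UniformOn W k 𝒢 → UniformOn W k ℋ → CrossIntersecting 𝒢 ℋ → k + k ≤ ∣ W ∣ →
  length 𝒢 + length ℋ ≤ ∣ W ∣ C k
cross-intersecting-sum≤C W k {𝒢} {ℋ} h𝒢 hℋ cross k+k≤∣W∣ =
  *-cancelʳ-≤ (length 𝒢 + length ℋ) c c {{k≤n⇒nCk≢0 (≤-trans (m≤m+n k k) k+k≤∣W∣)}}
    (subst (_≤ c * c) (sym (*-distribʳ-+ c (length 𝒢) (length ℋ)))
      (cross-intersecting-bound W k k h𝒢 hℋ cross k+k≤∣W∣))
  where
  c : ℕ
  c = ∣ W ∣ C k

-- Traces

contains-avoids⇒trace : {F P Q : Subset n} → P ⊆ F → F ∩ Q ≡ ⊥ → F ∩ (P ∪ Q) ≡ P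
contains-avoids⇒trace {F = F} {P} {Q} P⊆F F∩Q≡⊥ = begin
  F ∩ (P ∪ Q)       ≡⟨ ∩-distribˡ-∪ F P Q ⟩
  (F ∩ P) ∪ (F ∩ Q) ≡⟨ cong₂ _∪_ (p⊆q⇒q∩p≡p P⊆F) F∩Q≡⊥ ⟩
  P ∪ ⊥             ≡⟨ ∪-identityʳ P ⟩
  P                 ∎
  where open ≡-Reasoning

trace-on-pair : {F U P Q : Subset n} → P ⊆ U → Q ⊆ U → P ∩ Q ≡ ⊥ →
  F ∩ U ≡ P ⊎ F ∩ U ≡ U ─ Q → F ∩ (P ∪ Q) ≡ P
trace-on-pair P⊆U Q⊆U P∩Q≡⊥ (inj₁ F∩U≡P) = contains-avoids⇒trace
  (p∩q≡r⇒r⊆p F∩U≡P)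
  (trans (trace-restrict F∩U≡P Q⊆U) P∩Q≡⊥)
trace-on-pair {U = U} {Q = Q} P⊆U Q⊆U P∩Q≡⊥ (inj₂ F∩U≡U─Q) = contains-avoids⇒trace
  (λ x∈P → p∩q≡r⇒r⊆p F∩U≡U─Q (x∈p∧x∉q⇒x∈p─q (P⊆U x∈P) (disjoint⇒∉ P∩Q≡⊥ x∈P)))
  (trans (trace-restrict F∩U≡U─Q Q⊆U) ([p─q]∩q≡⊥ U Q))

complement-traces-on : {X P : Subset n} {t k : ℕ} {ℒ : Family n} →
  Unique ℒ → Uniform (t + k) ℒ → ∣ P ∣ ≡ t → (∀ {F} → F ∈ₗ ℒ → F ∩ X ≡ P) →
  UniformOn (∁ X) k (map (_∩ ∁ X) ℒ)
complement-traces-on {X = X} {P} {t} {k} {ℒ} ℒ! ℒ-uniform ∣P∣≡t trace≡P = record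
  { unique  = map⁻ {f = P ∪_} (subst Unique (sym (trans (sym (map-∘ ℒ)) (map-id-local (All.tabulate recover)))) ℒ!)
  ; uniform = λ G∈ → let (F , F∈ℒ , G≡F∩∁X) = ∈-map⁻ (_∩ ∁ X) G∈ in
      trans (cong ∣_∣ G≡F∩∁X) (∣trace∣≡k F∈ℒ)
  ; within  = λ G∈ → let (F , _ , G≡F∩∁X) = ∈-map⁻ (_∩ ∁ X) G∈ in
      subst (_⊆ ∁ X) (sym G≡F∩∁X) (p∩q⊆q F (∁ X))
  }
  where
  open ≡-Reasoning
  ∣trace∣≡k : ∀ {F} → F ∈ₗ ℒ → ∣ F ∩ ∁ X ∣ ≡ k
  ∣trace∣≡k {F} F∈ℒ = +-cancelˡ-≡ t _ _ (begin
    t + ∣ F ∩ ∁ X ∣         ≡⟨ cong (_+ ∣ F ∩ ∁ X ∣) (sym (trans (cong ∣_∣ (trace≡P F∈ℒ)) ∣P∣≡t)) ⟩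
    ∣ F ∩ X ∣ + ∣ F ∩ ∁ X ∣ ≡⟨ sym (∣p∣≡∣p∩q∣+∣p∩∁q∣ F X) ⟩
    ∣ F ∣                   ≡⟨ ℒ-uniform F∈ℒ ⟩
    t + k                   ∎)
  recover : ∀ {F} → F ∈ₗ ℒ → P ∪ (F ∩ ∁ X) ≡ F
  recover {F} F∈ℒ = sym (trans (p≡[p∩q]∪[p∩∁q] F X) (cong (_∪ (F ∩ ∁ X)) (trace≡P F∈ℒ)))

complement-traces-cross : {X P Q : Subset n} {ℒ ℳ : Family n} → P ∩ Q ≡ ⊥ →
  (∀ {F} → F ∈ₗ ℒ → F ∩ X ≡ P) → (∀ {F} → F ∈ₗ ℳ → F ∩ X ≡ Q) →
  CrossIntersecting ℒ ℳ → CrossIntersecting (map (_∩ ∁ X) ℒ) (map (_∩ ∁ X) ℳ)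
complement-traces-cross {X = X} P∩Q≡⊥ trace≡P trace≡Q cross G∈ H∈
  with ∈-map⁻ (_∩ ∁ X) G∈ | ∈-map⁻ (_∩ ∁ X) H∈
... | F , F∈ℒ , refl | F′ , F′∈ℳ , refl with cross F∈ℒ F′∈ℳ
...   | i , i∈F∩F′ with x∈p∩q⁻ F F′ i∈F∩F′ | i ∈? X
...     | i∈F , i∈F′ | yes i∈X = ⊥-elim (disjoint⇒∉ P∩Q≡⊥
            (subst (i ∈_) (trace≡P F∈ℒ) (x∈p∩q⁺ (i∈F , i∈X)))
            (subst (i ∈_) (trace≡Q F′∈ℳ) (x∈p∩q⁺ (i∈F′ , i∈X))))
...     | i∈F , i∈F′ | no  i∉X =
            i , x∈p∩q⁺ (x∈p∩q⁺ (i∈F , x∉p⇒x∈∁p i∉X) , x∈p∩q⁺ (i∈F′ , x∉p⇒x∈∁p i∉X))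

-- Counting members by their trace on U

length-filter-⊎ : {A : Set} {P Q : A → Set} (P? : Decidable P) (Q? : Decidable Q) →
  (∀ {x} → P x → ¬ Q x) → (xs : List A) →
  length (filter (λ x → P? x ⊎-dec Q? x) xs) ≡ length (filter P? xs) + length (filter Q? xs)
length-filter-⊎ P? Q? disjoint [] = refl
length-filter-⊎ P? Q? disjoint (x ∷ xs) with P? x | Q? x
... | yes Px | yes Qx = ⊥-elim (disjoint Px Qx)
... | yes _  | no  _  = cong suc (length-filter-⊎ P? Q? disjoint xs)
... | no  _  | yes _  = trans (cong suc (length-filter-⊎ P? Q? disjoint xs)) (sym (+-suc _ _))
... | no  _  | no  _  = length-filter-⊎ P? Q? disjoint xs

trace≟ : (U S : Subset n) → Decidable (λ F → F ∩ U ≡ S)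
trace≟ U S F = ≡-dec _≟ᵇ_ (F ∩ U) S

trace∈? : (U P Q : Subset n) → Decidable (λ F → F ∩ U ≡ P ⊎ F ∩ U ≡ U ─ Q)
trace∈? U P Q F = trace≟ U P F ⊎-dec trace≟ U (U ─ Q) F

length-filter-trace∈ : {U P Q : Subset n} (ℱ : Family n) → Q ⊆ U → ∣ U ∣ ≢ ∣ Q ∣ + ∣ P ∣ →
  length (filter (trace∈? U P Q) ℱ) ≡ length (filter (trace≟ U P) ℱ) + length (filter (trace≟ U (U ─ Q)) ℱ)
length-filter-trace∈ {U = U} {P} {Q} ℱ Q⊆U ∣U∣≢∣Q∣+∣P∣ =
  length-filter-⊎ (trace≟ U P) (trace≟ U (U ─ Q))
    (λ F∩U≡P F∩U≡U─Q → ∣U∣≢∣Q∣+∣P∣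
      (trans (∣p∣≡∣q∣+∣p─q∣ Q⊆U) (cong (λ S → ∣ Q ∣ + ∣ S ∣) (trans (sym F∩U≡U─Q) F∩U≡P))))
    ℱ

2*[2+k]<n⇒5≤n : ∀ k → 2 * (2 + k) < n → 5 ≤ n
2*[2+k]<n⇒5≤n k 2k<n = ≤-trans (s≤s (*-monoʳ-≤ 2 (m≤m+n 2 k))) 2k<n

2*[2+k]<n⇒k+k≤n∸4 : ∀ k → 2 * (2 + k) < n → k + k ≤ n ∸ 4
2*[2+k]<n⇒k+k≤n∸4 k 2k<n = m+n≤o⇒m≤o∸n (k + k) (≤-trans (≤-reflexive (k+k+4≡2*[2+k] k)) (<⇒≤ 2k<n))
  where
  k+k+4≡2*[2+k] : ∀ k → k + k + 4 ≡ 2 * (2 + k)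
  k+k+4≡2*[2+k] = solve-∀

paired-classes-bound : {k : ℕ} (ℱ : Family n) → Unique ℱ → Uniform (2 + k) ℱ → Intersecting ℱ →
  2 * (2 + k) < n → {P Q : Subset n} → P ⊆ U5 → ∣ P ∣ ≡ 2 → Q ⊆ U5 → ∣ Q ∣ ≡ 2 → P ∩ Q ≡ ⊥ →
  (f ℱ P + f ℱ (U5 ─ Q)) + (f ℱ Q + f ℱ (U5 ─ P)) ≤ (n ∸ 4) C k
paired-classes-bound {n} {k} ℱ ℱ! ℱ-uniform ℱ-intersecting 2k<n {P} {Q}
                     P⊆U5 ∣P∣≡2 Q⊆U5 ∣Q∣≡2 P∩Q≡⊥ = begin
  (f ℱ P + f ℱ (U5 ─ Q)) + (f ℱ Q + f ℱ (U5 ─ P))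
    ≡⟨ sym (cong₂ _+_ (length-filter-trace∈ ℱ Q⊆U5 (∣U5∣≢2+2 Q P ∣Q∣≡2 ∣P∣≡2))
                      (length-filter-trace∈ ℱ P⊆U5 (∣U5∣≢2+2 P Q ∣P∣≡2 ∣Q∣≡2))) ⟩
  length (class P Q) + length (class Q P)
    ≡⟨ sym (cong₂ _+_ (length-map (_∩ W) (class P Q)) (length-map (_∩ W) (class Q P))) ⟩
  length (map (_∩ W) (class P Q)) + length (map (_∩ W) (class Q P))
    ≤⟨ cross-intersecting-sum≤C W k (traces-on ∣P∣≡2 trace≡P) (traces-on ∣Q∣≡2 trace≡Q)
         (complement-traces-cross P∩Q≡⊥ trace≡P trace≡Q
           (λ F∈ G∈ → ℱ-intersecting (proj₁ (∈-filter⁻ (trace∈? U5 P Q) {xs = ℱ} F∈))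
                                     (proj₁ (∈-filter⁻ (trace∈? U5 Q P) {xs = ℱ} G∈))))
         (subst (k + k ≤_) (sym ∣W∣≡n∸4) (2*[2+k]<n⇒k+k≤n∸4 k 2k<n)) ⟩
  ∣ W ∣ C k
    ≡⟨ cong (_C k) ∣W∣≡n∸4 ⟩
  (n ∸ 4) C k ∎
  where
  open ≤-Reasoning
  W : Subset n
  W = ∁ (P ∪ Q)
  class : Subset n → Subset n → Family n
  class A B = filter (trace∈? U5 A B) ℱ
  ∣U5∣≢2+2 : ∀ A B → ∣ A ∣ ≡ 2 → ∣ B ∣ ≡ 2 → ∣ U5 {n} ∣ ≢ ∣ A ∣ + ∣ B ∣
  ∣U5∣≢2+2 _ _ ∣A∣≡2 ∣B∣≡2 eq
    with trans (sym (∣U5∣≡5 (2*[2+k]<n⇒5≤n k 2k<n))) (trans eq (cong₂ _+_ ∣A∣≡2 ∣B∣≡2))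
  ... | ()
  trace≡P : ∀ {F} → F ∈ₗ class P Q → F ∩ (P ∪ Q) ≡ P
  trace≡P F∈ = trace-on-pair P⊆U5 Q⊆U5 P∩Q≡⊥ (proj₂ (∈-filter⁻ (trace∈? U5 P Q) {xs = ℱ} F∈))
  trace≡Q : ∀ {F} → F ∈ₗ class Q P → F ∩ (P ∪ Q) ≡ Q
  trace≡Q F∈ = subst (λ X → _ ∩ X ≡ Q) (∪-comm Q P)
    (trace-on-pair Q⊆U5 P⊆U5 (trans (∩-comm Q P) P∩Q≡⊥) (proj₂ (∈-filter⁻ (trace∈? U5 Q P) {xs = ℱ} F∈)))
  traces-on : ∀ {A B} → ∣ A ∣ ≡ 2 → (∀ {F} → F ∈ₗ class A B → F ∩ (P ∪ Q) ≡ A) →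
    UniformOn W k (map (_∩ W) (class A B))
  traces-on {A} {B} ∣A∣≡2 trace≡A = complement-traces-on (filter⁺ (trace∈? U5 A B) ℱ!)
    (λ F∈ → ℱ-uniform (proj₁ (∈-filter⁻ (trace∈? U5 A B) {xs = ℱ} F∈))) ∣A∣≡2 trace≡A
  ∣W∣≡n∸4 : ∣ W ∣ ≡ n ∸ 4
  ∣W∣≡n∸4 = trans (∣∁p∣≡n∸∣p∣ (P ∪ Q))
    (cong (n ∸_) (trans (∣p∪q∣≡∣p∣+∣q∣ P Q P∩Q≡⊥) (cong₂ _+_ ∣P∣≡2 ∣Q∣≡2)))

proposition3p6 : (n k : ℕ) → 2 * k < n → (ℱ : Family n) → Unique ℱ →
    Uniform k ℱ → Intersecting ℱ → τ≥ ℱ 3 →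
    (∀ {F} → F ∈ₗ ℱ → 2 ≤ ∣ F ∩ U5 ∣) →
    (P P′ : Subset n) → P ⊆ U5 → ∣ P ∣ ≡ 2 → P′ ⊆ U5 → ∣ P′ ∣ ≡ 2 → P ∩ P′ ≡ ⊥ →
    f ℱ P + f ℱ P′ + f ℱ (U5 ─ P) + f ℱ (U5 ─ P′)
      ≤ ((n ∸ 5) C (k ∸ 2)) + ((n ∸ 5) C (k ∸ 3))
proposition3p6 n (suc (suc k)) 2k<n ℱ ℱ! ℱ-uniform ℱ-intersecting _ _
               P P′ P⊆U5 ∣P∣≡2 P′⊆U5 ∣P′∣≡2 P∩P′≡⊥ = begin
  f ℱ P + f ℱ P′ + f ℱ (U5 ─ P) + f ℱ (U5 ─ P′)
    ≡⟨ regroup (f ℱ P) (f ℱ P′) (f ℱ (U5 ─ P)) (f ℱ (U5 ─ P′)) ⟩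
  (f ℱ P + f ℱ (U5 ─ P′)) + (f ℱ P′ + f ℱ (U5 ─ P))
    ≤⟨ paired-classes-bound ℱ ℱ! ℱ-uniform ℱ-intersecting 2k<n P⊆U5 ∣P∣≡2 P′⊆U5 ∣P′∣≡2 P∩P′≡⊥ ⟩
  (n ∸ 4) C k
    ≡⟨ cong (_C k) (+-∸-assoc 1 (2*[2+k]<n⇒5≤n k 2k<n)) ⟩
  suc (n ∸ 5) C k
    ≤⟨ [1+n]Ck≤nCk+nC[k∸1] (n ∸ 5) k ⟩
  (n ∸ 5) C k + (n ∸ 5) C (k ∸ 1) ∎
  where
  open ≤-Reasoning
  regroup : ∀ a b c d → a + b + c + d ≡ (a + d) + (b + c)
  regroup = solve-∀
proposition3p6 n k _ [] _ _ _ _ _ _ _ _ _ _ _ _ = z≤n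
proposition3p6 n zero _ (F ∷ _) _ ℱ-uniform _ _ 2≤∣F∩U5∣ _ _ _ _ _ _ _
  with ≤-trans (2≤∣F∩U5∣ (here refl)) (≤-trans (∣p∩q∣≤∣p∣ F U5) (≤-reflexive (ℱ-uniform (here refl))))
... | ()
proposition3p6 n (suc zero) _ (F ∷ _) _ ℱ-uniform _ _ 2≤∣F∩U5∣ _ _ _ _ _ _ _
  with ≤-trans (2≤∣F∩U5∣ (here refl)) (≤-trans (∣p∩q∣≤∣p∣ F U5) (≤-reflexive (ℱ-uniform (here refl))))
... | s≤s ()
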